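{- Let $n\ge 3$, let $1\le i_0<j_0\le n$ with $j_0\ge i_0+2$, let $\alpha=\varepsilon_{i_0}-\varepsilon_{j_0}$, $s=s_\alpha$, and let $w\in S_n$ satisfy $w(i_0)<w(j_0)$ and such that no $k$ with $i_0<k<j_0$ satisfies $w(i_0)<w(k)<w(j_0)$; put $w'=ws$. Let $\beta$ be a negative root sharing the column of $\alpha$. If $\beta$ is bad, then $(\beta_1,\beta_2)\mapsto(s(\beta_1),\beta_2)$ is a bijection from $\mathfrak{A}_\beta$ onto the set of elements $(\beta_1,\beta_2)\in\mathfrak{A}_{s(\beta)}$ such that $s(\beta_1)$ is a bad (negative) root. Moreover, if $\beta$ is not bad and $(\beta_1,\beta_2)\in\mathfrak{A}_{s(\beta)}$, then $s(\beta_1)$ is not a bad root.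
   Context: $S_n$ acts on $\mathbb{Z}^n$ by $w(\varepsilon_i)=\varepsilon_{w(i)}$. For $l\ne m$, $\alpha_{lm}=\varepsilon_l-\varepsilon_m$, positive if $l<m$, negative if $l>m$; $w(\alpha_{lm})=\alpha_{w(l)w(m)}$. $s=s_\alpha$ is the transposition $(i_0\,j_0)$ acting by $s(\alpha_{lm})=\alpha_{s(l)s(m)}$. $\delta_P$ is $1$ if $P$ holds, else $0$. For a negative root $\beta=\alpha_{lm}$: it shares the row of $\alpha$ if $l=i_0$, the column of $\alpha$ if $m=j_0$, the row of $-\alpha$ if $l=j_0$, the column of $-\alpha$ if $m=i_0$. A negative root $\beta$ is bad if it shares the row or column of $\alpha$ and $\delta_{w(\beta)<0}\ne\delta_{w'(\beta)<0}$ (only negative roots can be bad). $\kappa_\beta=\delta_{w'(\beta)<0}$ if $l=j_0$, and $\kappa_\beta=\delta_{w(\beta)<0}$ otherwise. $\mathfrak{D}_\beta=\{(\alpha_{km},\alpha_{lk}):m<k<l\}$, and for any negative root $\gamma$, $\mathfrak{A}_\gamma=\{(\gamma_1,\gamma_2)\in\mathfrak{D}_\gamma:\kappa_\gamma=\kappa_{\gamma_1}+\kappa_{\gamma_2}\}$. -}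

module Defs where

open import Data.Nat using (ℕ; zero; suc; _+_)
open import Data.Bool using (Bool; true; false; if_then_else_)
open import Data.Fin using (Fin; toℕ; _<_)
open import Data.Fin.Properties using (_<?_; _≟_)
open import Data.Fin.Permutation using (Permutation′; _⟨$⟩ʳ_; transpose)
open import Data.Product using (Σ; ∃; _×_; _,_; proj₁; proj₂)
open import Data.Sum using (_⊎_)
open import Relation.Nullary using (¬_)
open import Relation.Nullary.Decidable using (⌊_⌋)
open import Relation.Binary.PropositionalEquality using (_≡_; _≢_)

-- Indices 1..n of the paper are represented by Fin n (0-based); the order
-- on Fin n agrees with the order on indices.

-- A root α_{lm} = ε_l - ε_m is represented by the pair (l , m) (with l ≠ m
-- wherever it matters; all roots appearing below satisfy this).
Root : ℕ → Set
Root n = Fin n × Fin n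

Negative : ∀ {n} → Root n → Set
Negative (l , m) = m < l

δ : Bool → ℕ
δ b = if b then 1 else 0

-- The setup: α = ε_{i0} - ε_{j0}, s = s_α = (i0 j0), w ∈ S_n, w' = w s.
module Setup {n : ℕ} (i0 j0 : Fin n) (w : Permutation′ n) where

  s : Permutation′ n
  s = transpose i0 j0

  w′ : Fin n → Fin n
  w′ i = w ⟨$⟩ʳ (s ⟨$⟩ʳ i)

  sR : Root n → Root n
  sR (l , m) = (s ⟨$⟩ʳ l , s ⟨$⟩ʳ m)

  wNeg : Root n → Bool
  wNeg (l , m) = ⌊ (w ⟨$⟩ʳ m) <? (w ⟨$⟩ʳ l) ⌋

  w′Neg : Root n → Bool
  w′Neg (l , m) = ⌊ w′ m <? w′ l ⌋

  SharesRowOrColumnOfα : Root n → Set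
  SharesRowOrColumnOfα (l , m) = (l ≡ i0) ⊎ (m ≡ j0)

  Bad : Root n → Set
  Bad β = Negative β × SharesRowOrColumnOfα β × (δ (wNeg β) ≢ δ (w′Neg β))

  κ : Root n → ℕ
  κ (l , m) = if ⌊ l ≟ j0 ⌋ then δ (w′Neg (l , m)) else δ (wNeg (l , m))

  𝔇 : Root n → Root n × Root n → Set
  𝔇 (l , m) (γ₁ , γ₂) = ∃ λ k → m < k × k < l × γ₁ ≡ (k , m) × γ₂ ≡ (l , k)

  𝔄 : Root n → Root n × Root n → Set
  𝔄 γ (γ₁ , γ₂) = 𝔇 γ (γ₁ , γ₂) × (κ γ ≡ κ γ₁ + κ γ₂)

  φ : Root n × Root n → Root n × Root n
  φ (β₁ , β₂) = (sR β₁ , β₂)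

{-# OPTIONS --safe #-}
-- Write a = w(i0), b = w(j0) and β = α_{l j0} with l > j0. Since s fixes every index
-- beyond j0, β is bad exactly when a < w(l) < b. Splitting κ_β = κ_{β₁} + κ_{β₂} into
-- inversion indicators shows that the pairs of 𝔄_β (when β is bad) and the pairs of
-- 𝔄_{s(β)} whose s(β₁) is bad are both indexed by the same k, namely those with
-- j0 < k < l and a < w(l) < w(k) < b; φ only exchanges α_{k j0} and α_{k i0}. The
-- existence of such a k already makes β bad, which gives the second statement.
-- Neither n ≥ 3 nor the condition on the indices strictly between i0 and j0 is used.
module Submission where

open import Defs
open import Data.Nat using (ℕ; suc; _≤_; _+_)
import Data.Nat.Properties as ℕ
open import Data.Fin using (Fin; toℕ; _<_)
  renaming (_≤_ to _≤ᶠ_)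
open import Data.Fin.Properties using (_<?_; _≟_; <-trans; <-asym; <⇒≢; ≤∧≢⇒<)
open import Data.Fin.Permutation using (Permutation′; _⟨$⟩ʳ_)
open import Data.Product using (∃; _×_; _,_; proj₁; proj₂)
open import Data.Sum using (inj₂)
open import Data.Empty using (⊥-elim)
open import Function.Base using (_∘′_)
open import Function.Bundles using (Injection)
open import Function.Properties.Inverse using (↔⇒↣)
open import Relation.Nullary using (¬_; yes; no)
open import Relation.Nullary.Decidable using (⌊_⌋; dec-true; dec-false)
open import Relation.Binary.PropositionalEquality
  using (_≡_; _≢_; refl; sym; trans; cong; cong₂; subst; subst₂; ≢-sym)

private variable
  n : ℕ

δ⌊<?⌋≡1 : {x y : Fin n} → x < y → δ ⌊ x <? y ⌋ ≡ 1
δ⌊<?⌋≡1 {x = x} {y} x<y with x <? y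
... | yes _   = refl
... | no x≮y = ⊥-elim (x≮y x<y)

δ⌊<?⌋≡0 : {x y : Fin n} → y ≤ᶠ x → δ ⌊ x <? y ⌋ ≡ 0
δ⌊<?⌋≡0 {x = x} {y} y≤x with x <? y
... | yes x<y = ⊥-elim (ℕ.≤⇒≯ y≤x x<y)
... | no _    = refl

δ⌊<?⌋-sum≡0 : {x y z : Fin n} → δ ⌊ x <? y ⌋ + δ ⌊ y <? z ⌋ ≡ 0 → y ≤ᶠ x × z ≤ᶠ y
δ⌊<?⌋-sum≡0 {x = x} {y} {z} eq with x <? y | y <? z
... | no x≮y | no y≮z = ℕ.≮⇒≥ x≮y , ℕ.≮⇒≥ y≮z

δ⌊<?⌋≡suc : {x y z : Fin n} → δ ⌊ x <? z ⌋ ≡ suc (δ ⌊ y <? z ⌋) → x < z × z ≤ᶠ y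
δ⌊<?⌋≡suc {x = x} {y} {z} eq with x <? z | y <? z
... | yes x<z | no y≮z = x<z , ℕ.≮⇒≥ y≮z

δ⌊<?⌋-differ⇒between : {x y z : Fin n} → x < y → δ ⌊ y <? z ⌋ ≢ δ ⌊ x <? z ⌋ → x < z × z ≤ᶠ y
δ⌊<?⌋-differ⇒between {x = x} {y} {z} x<y differ with x <? z | y <? z
... | yes x<z | no y≮z = x<z , ℕ.≮⇒≥ y≮z
... | yes _   | yes _  = ⊥-elim (differ refl)
... | no _    | no _   = ⊥-elim (differ refl)
... | no x≮z  | yes y<z = ⊥-elim (x≮z (<-trans x<y y<z))

between⇒δ⌊<?⌋-differ : {x y z : Fin n} → x < z → z ≤ᶠ y → δ ⌊ y <? z ⌋ ≢ δ ⌊ x <? z ⌋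
between⇒δ⌊<?⌋-differ x<z z≤y eq with trans (sym (δ⌊<?⌋≡0 z≤y)) (trans eq (δ⌊<?⌋≡1 x<z))
... | ()

module ColumnOfα {n : ℕ} (i0 j0 : Fin n) (w : Permutation′ n)
                 (i0<j0 : i0 < j0) (a<b : w ⟨$⟩ʳ i0 < w ⟨$⟩ʳ j0) where
  open Setup i0 j0 w

  a b : Fin n
  a = w ⟨$⟩ʳ i0
  b = w ⟨$⟩ʳ j0

  w-injective : ∀ {x y} → w ⟨$⟩ʳ x ≡ w ⟨$⟩ʳ y → x ≡ y
  w-injective = Injection.injective (↔⇒↣ w)

  w-<-≢ : ∀ {x y} → x < y → w ⟨$⟩ʳ y ≢ w ⟨$⟩ʳ x
  w-<-≢ x<y = ≢-sym (<⇒≢ x<y) ∘′ w-injective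

  s-fix : ∀ {k} → k ≢ i0 → k ≢ j0 → s ⟨$⟩ʳ k ≡ k
  s-fix {k} k≢i0 k≢j0 rewrite dec-false (k ≟ i0) k≢i0 | dec-false (k ≟ j0) k≢j0 = refl

  s-i0 : s ⟨$⟩ʳ i0 ≡ j0
  s-i0 rewrite dec-true (i0 ≟ i0) refl = refl

  s-j0 : s ⟨$⟩ʳ j0 ≡ i0
  s-j0 rewrite dec-false (j0 ≟ i0) (≢-sym (<⇒≢ i0<j0)) | dec-true (j0 ≟ j0) refl = refl

  beyond-j0⇒≢j0 : ∀ {k} → j0 < k → k ≢ j0
  beyond-j0⇒≢j0 j0<k = ≢-sym (<⇒≢ j0<k)

  s-fix-beyond-j0 : ∀ {k} → j0 < k → s ⟨$⟩ʳ k ≡ k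
  s-fix-beyond-j0 j0<k = s-fix (≢-sym (<⇒≢ (<-trans i0<j0 j0<k))) (beyond-j0⇒≢j0 j0<k)

  sR-column-α : ∀ {k} → j0 < k → sR (k , j0) ≡ (k , i0)
  sR-column-α j0<k = cong₂ _,_ (s-fix-beyond-j0 j0<k) s-j0

  sR-column-−α : ∀ {k} → j0 < k → sR (k , i0) ≡ (k , j0)
  sR-column-−α j0<k = cong₂ _,_ (s-fix-beyond-j0 j0<k) s-i0

  κ-beyond-j0 : ∀ {l m} → j0 < l → κ (l , m) ≡ δ (wNeg (l , m))
  κ-beyond-j0 {l} j0<l with l ≟ j0
  ... | yes l≡j0 = ⊥-elim (beyond-j0⇒≢j0 j0<l l≡j0)
  ... | no _     = refl

  module _ {l k m : Fin n} (j0<k : j0 < k) (k<l : k < l) where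

    κ-additive⇒wNeg-additive : κ (l , m) ≡ κ (k , m) + κ (l , k) →
                               δ (wNeg (l , m)) ≡ δ (wNeg (k , m)) + δ (wNeg (l , k))
    κ-additive⇒wNeg-additive eq =
      trans (sym (κ-beyond-j0 j0<l)) (trans eq (cong₂ _+_ (κ-beyond-j0 j0<k) (κ-beyond-j0 j0<l)))
      where j0<l = <-trans j0<k k<l

    wNeg-additive⇒κ-additive : δ (wNeg (l , m)) ≡ δ (wNeg (k , m)) + δ (wNeg (l , k)) →
                               κ (l , m) ≡ κ (k , m) + κ (l , k)
    wNeg-additive⇒κ-additive eq =
      trans (κ-beyond-j0 j0<l) (trans eq (sym (cong₂ _+_ (κ-beyond-j0 j0<k) (κ-beyond-j0 j0<l))))
      where j0<l = <-trans j0<k k<l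

  w′Neg-column-α : ∀ {l} → j0 < l → w′Neg (l , j0) ≡ wNeg (l , i0)
  w′Neg-column-α j0<l = cong wNeg (sR-column-α j0<l)

  bad-column-α⇒between : ∀ {l} → j0 < l → Bad (l , j0) → a < w ⟨$⟩ʳ l × w ⟨$⟩ʳ l < b
  bad-column-α⇒between {l} j0<l (_ , _ , differ) =
    a<wl , ≤∧≢⇒< wl≤b (w-<-≢ j0<l)
    where
    a<wl×wl≤b = δ⌊<?⌋-differ⇒between a<b
      (subst (λ t → δ (wNeg (l , j0)) ≢ δ t) (w′Neg-column-α j0<l) differ)
    a<wl = proj₁ a<wl×wl≤b
    wl≤b = proj₂ a<wl×wl≤b

  between⇒bad-column-α : ∀ {l} → j0 < l → a < w ⟨$⟩ʳ l → w ⟨$⟩ʳ l < b → Bad (l , j0)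
  between⇒bad-column-α {l} j0<l a<wl wl<b = j0<l , inj₂ refl ,
    subst (λ t → δ (wNeg (l , j0)) ≢ δ t) (sym (w′Neg-column-α j0<l))
      (between⇒δ⌊<?⌋-differ a<wl (ℕ.<⇒≤ wl<b))

  bad-sR-column-−α⇒beyond-j0 : ∀ {k} → i0 < k → Bad (sR (k , i0)) → j0 < k
  bad-sR-column-−α⇒beyond-j0 {k} i0<k (negative , _) with k ≟ j0
  ... | yes refl = ⊥-elim (<-asym i0<j0 (subst₂ _<_ s-i0 s-j0 negative))
  ... | no k≢j0  = subst₂ _<_ s-i0 (s-fix (≢-sym (<⇒≢ i0<k)) k≢j0) negative

  record Admissible (l k : Fin n) : Set where
    field
      j0<k  : j0 < k
      k<l   : k < l
      a<wl  : a < w ⟨$⟩ʳ l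
      wl<wk : w ⟨$⟩ʳ l < w ⟨$⟩ʳ k
      wk<b  : w ⟨$⟩ʳ k < b

  module _ {l k : Fin n} (adm : Admissible l k) where
    open Admissible adm

    admissible⇒bad-column-α : Bad (l , j0)
    admissible⇒bad-column-α = between⇒bad-column-α (<-trans j0<k k<l) a<wl (<-trans wl<wk wk<b)

    admissible⇒bad-sR-column-−α : Bad (sR (k , i0))
    admissible⇒bad-sR-column-−α =
      subst Bad (sym (sR-column-−α j0<k)) (between⇒bad-column-α j0<k (<-trans a<wl wl<wk) wk<b)

    admissible⇒𝔄-column-α : 𝔄 (l , j0) ((k , j0) , (l , k))
    admissible⇒𝔄-column-α = (k , j0<k , k<l , refl , refl) ,
      wNeg-additive⇒κ-additive j0<k k<l (trans (δ⌊<?⌋≡0 (ℕ.<⇒≤ (<-trans wl<wk wk<b)))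
        (sym (cong₂ _+_ (δ⌊<?⌋≡0 (ℕ.<⇒≤ wk<b)) (δ⌊<?⌋≡0 (ℕ.<⇒≤ wl<wk)))))

    admissible⇒𝔄-column-−α : 𝔄 (l , i0) ((k , i0) , (l , k))
    admissible⇒𝔄-column-−α = (k , <-trans i0<j0 j0<k , k<l , refl , refl) ,
      wNeg-additive⇒κ-additive j0<k k<l (trans (δ⌊<?⌋≡1 a<wl)
        (sym (cong₂ _+_ (δ⌊<?⌋≡1 (<-trans a<wl wl<wk)) (δ⌊<?⌋≡0 (ℕ.<⇒≤ wl<wk)))))

  𝔄-column-α⇒admissible : ∀ {l p} → j0 < l → Bad (l , j0) → 𝔄 (l , j0) p →
                          ∃ λ k → Admissible l k × p ≡ ((k , j0) , (l , k))
  𝔄-column-α⇒admissible {l} j0<l bad ((k , j0<k , k<l , refl , refl) , κ-eq) =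
    k , record { j0<k = j0<k ; k<l = k<l ; a<wl = a<wl
               ; wl<wk = ≤∧≢⇒< wl≤wk (w-<-≢ k<l) ; wk<b = ≤∧≢⇒< wk≤b (w-<-≢ j0<k) } , refl
    where
    a<wl = proj₁ (bad-column-α⇒between j0<l bad)
    wl<b = proj₂ (bad-column-α⇒between j0<l bad)
    -- κ_β = 0, so both summands vanish
    wk≤b×wl≤wk = δ⌊<?⌋-sum≡0 (trans (sym (κ-additive⇒wNeg-additive j0<k k<l κ-eq)) (δ⌊<?⌋≡0 (ℕ.<⇒≤ wl<b)))
    wk≤b = proj₁ wk≤b×wl≤wk
    wl≤wk = proj₂ wk≤b×wl≤wk

  𝔄-column-−α⇒admissible : ∀ {l q} → 𝔄 (l , i0) q → Bad (sR (proj₁ q)) →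
                           ∃ λ k → Admissible l k × q ≡ ((k , i0) , (l , k))
  𝔄-column-−α⇒admissible {l} ((k , i0<k , k<l , refl , refl) , κ-eq) bad =
    k , record { j0<k = j0<k ; k<l = k<l ; a<wl = proj₁ a<wl×wl≤wk
               ; wl<wk = ≤∧≢⇒< (proj₂ a<wl×wl≤wk) (w-<-≢ k<l) ; wk<b = proj₂ a<wk×wk<b } , refl
    where
    j0<k = bad-sR-column-−α⇒beyond-j0 i0<k bad
    a<wk×wk<b = bad-column-α⇒between j0<k (subst Bad (sR-column-−α j0<k) bad)
    a<wl×wl≤wk = δ⌊<?⌋≡suc (trans (κ-additive⇒wNeg-additive j0<k k<l κ-eq)
                                   (cong (_+ δ (wNeg (l , k))) (δ⌊<?⌋≡1 (proj₁ a<wk×wk<b))))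

  φ-injective-on-𝔇 : ∀ {β p q} → 𝔇 β p → 𝔇 β q → φ p ≡ φ q → p ≡ q
  φ-injective-on-𝔇 {l , m} (_ , _ , _ , refl , refl) (_ , _ , _ , refl , refl) eq =
    cong (λ k → (k , m) , (l , k)) (cong (proj₂ ∘′ proj₂) eq)

  module _ {l : Fin n} (j0<l : j0 < l) where

    φ-maps-𝔄-into-bad-part : Bad (l , j0) → ∀ p → 𝔄 (l , j0) p →
                             𝔄 (sR (l , j0)) (φ p) × Bad (sR (proj₁ (φ p)))
    φ-maps-𝔄-into-bad-part bad p A with 𝔄-column-α⇒admissible j0<l bad A
    ... | k , adm , refl =
      subst₂ 𝔄 (sym (sR-column-α j0<l)) (cong (_, (l , k)) (sym (sR-column-α j0<k)))
        (admissible⇒𝔄-column-−α adm) ,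
      subst (Bad ∘′ sR) (sym (sR-column-α j0<k)) (admissible⇒bad-sR-column-−α adm)
      where open Admissible adm

    bad-part-⊆-φ-image : ∀ q → 𝔄 (sR (l , j0)) q → Bad (sR (proj₁ q)) →
                         ∃ λ p → 𝔄 (l , j0) p × φ p ≡ q
    bad-part-⊆-φ-image q A bad with 𝔄-column-−α⇒admissible (subst (λ γ → 𝔄 γ q) (sR-column-α j0<l) A) bad
    ... | k , adm , refl =
      ((k , j0) , (l , k)) , admissible⇒𝔄-column-α adm , cong (_, (l , k)) (sR-column-α j0<k)
      where open Admissible adm

    bad-part-nonempty⇒bad : ∀ q → 𝔄 (sR (l , j0)) q → Bad (sR (proj₁ q)) → Bad (l , j0)
    bad-part-nonempty⇒bad q A bad =
      admissible⇒bad-column-α (proj₁ (proj₂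
        (𝔄-column-−α⇒admissible (subst (λ γ → 𝔄 γ q) (sR-column-α j0<l) A) bad)))

lemma3p1p5 : (n : ℕ) → 3 ≤ n → (i0 j0 : Fin n) → 2 + toℕ i0 ≤ toℕ j0 →
    (w : Permutation′ n) → (w ⟨$⟩ʳ i0) < (w ⟨$⟩ʳ j0) →
    (∀ k → i0 < k → k < j0 → ¬ ((w ⟨$⟩ʳ i0) < (w ⟨$⟩ʳ k) × (w ⟨$⟩ʳ k) < (w ⟨$⟩ʳ j0))) →
    (β : Root n) → Negative β → proj₂ β ≡ j0 →
    (Setup.Bad i0 j0 w β →
        ((∀ p → Setup.𝔄 i0 j0 w β p →
            Setup.𝔄 i0 j0 w (Setup.sR i0 j0 w β) (Setup.φ i0 j0 w p)
            × Setup.Bad i0 j0 w (Setup.sR i0 j0 w (proj₁ (Setup.φ i0 j0 w p))))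
        × (∀ p q → Setup.𝔄 i0 j0 w β p → Setup.𝔄 i0 j0 w β q →
            Setup.φ i0 j0 w p ≡ Setup.φ i0 j0 w q → p ≡ q)
        × (∀ q → Setup.𝔄 i0 j0 w (Setup.sR i0 j0 w β) q →
            Setup.Bad i0 j0 w (Setup.sR i0 j0 w (proj₁ q)) →
            ∃ λ p → Setup.𝔄 i0 j0 w β p × Setup.φ i0 j0 w p ≡ q)))
    × (¬ Setup.Bad i0 j0 w β →
        ∀ q → Setup.𝔄 i0 j0 w (Setup.sR i0 j0 w β) q →
          ¬ Setup.Bad i0 j0 w (Setup.sR i0 j0 w (proj₁ q)))
lemma3p1p5 _ _ i0 j0 2+i0≤j0 w a<b _ (l , .j0) j0<l refl =
  (λ bad → φ-maps-𝔄-into-bad-part j0<l bad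
         , (λ _ _ A A′ → φ-injective-on-𝔇 (proj₁ A) (proj₁ A′))
         , bad-part-⊆-φ-image j0<l)
  , λ ¬bad q A bad-sβ₁ → ¬bad (bad-part-nonempty⇒bad j0<l q A bad-sβ₁)
  where open ColumnOfα i0 j0 w (ℕ.<⇒≤ 2+i0≤j0) a<b
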